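{- Let $G$ be a connected graph. Then $vcfc(G)\le r(G)$.
   Context: A $k$-ranking of a connected graph $G$ is a labeling of its vertices with labels $1,2,\dots,k$ such that every path between any two vertices with the same label $i$ contains at least one vertex with label $j>i$; $r(G)$ is the minimum $k$ for which $G$ has a $k$-ranking. Vertex-colorings are arbitrary, not necessarily proper. A path in a vertex-colored graph is called conflict-free if there is a color used on exactly one of its vertices. A vertex-colored graph is conflict-free vertex-connected if any two vertices of the graph are connected by a conflict-free path. For a connected graph $G$, the conflict-free vertex-connection number $vcfc(G)$ is the smallest number of colors needed in a vertex-coloring of $G$ that makes $G$ conflict-free vertex-connected. -}

module Defs where

open import Data.Nat using (ℕ; _≤_)
open import Data.Fin using (Fin; _<_; _≟_)
open import Data.List using (List; []; _∷_; filter; length)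
open import Data.List.Relation.Unary.Unique.Propositional using (Unique)
open import Data.List.Relation.Unary.Any using (Any)
open import Data.Product using (Σ; _×_; ∃)
open import Relation.Binary.PropositionalEquality using (_≡_; _≢_)
open import Relation.Nullary using (¬_)
open import Level using (0ℓ) renaming (suc to lsuc)

record Graph (n : ℕ) : Set₁ where
  field
    Adj     : Fin n → Fin n → Set
    sym     : ∀ {u v} → Adj u v → Adj v u
    irrefl  : ∀ {u} → ¬ Adj u u
open Graph public

data Walk {n : ℕ} (G : Graph n) : Fin n → Fin n → List (Fin n) → Set where
  here : ∀ {u} → Walk G u u (u ∷ [])
  step : ∀ {u w v vs} → Adj G u w → Walk G w v vs → Walk G u v (u ∷ vs)

Path : {n : ℕ} → Graph n → Fin n → Fin n → List (Fin n) → Set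
Path G u v vs = Walk G u v vs × Unique vs

Connected : {n : ℕ} → Graph n → Set
Connected G = ∀ u v → ∃ λ vs → Path G u v vs

-- k-ranking: labels Fin k (label i+1 is represented by i : Fin k, order preserved).
-- Any path between two distinct vertices with the same label contains a vertex
-- with a strictly larger label.
IsRanking : {n : ℕ} → Graph n → (k : ℕ) → (Fin n → Fin k) → Set
IsRanking G k f =
  ∀ u v → u ≢ v → f u ≡ f v → ∀ vs → Path G u v vs → Any (λ w → f u < f w) vs

HasRanking : {n : ℕ} → Graph n → ℕ → Set
HasRanking {n} G k = Σ (Fin n → Fin k) (IsRanking G k)

IsRankingNumber : {n : ℕ} → Graph n → ℕ → Set
IsRankingNumber G r = HasRanking G r × (∀ k → HasRanking G k → r ≤ k)

ConflictFree : {n k : ℕ} → (Fin n → Fin k) → List (Fin n) → Set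
ConflictFree {k = k} c vs = Σ (Fin k) λ i → length (filter (λ w → c w ≟ i) vs) ≡ 1

-- c makes G conflict-free vertex-connected (colourings need not be proper).
IsCFConnecting : {n : ℕ} → Graph n → (k : ℕ) → (Fin n → Fin k) → Set
IsCFConnecting G k c = ∀ u v → Σ (List _) λ vs → Path G u v vs × ConflictFree c vs

HasCFColoring : {n : ℕ} → Graph n → ℕ → Set
HasCFColoring {n} G k = Σ (Fin n → Fin k) (IsCFConnecting G k)

IsVcfc : {n : ℕ} → Graph n → ℕ → Set
IsVcfc G m = HasCFColoring G m × (∀ k → HasCFColoring G k → m ≤ k)

-- Under a ranking, the largest label on any path occurs on exactly one of its vertices,
-- so every ranking is itself a conflict-free connecting colouring. If two vertices
-- u, y of a path carry the maximal label, the segment of the path from u to y is itself a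
-- path whose labels are all at most that label, which the ranking condition forbids.
module Submission where

open import Defs hiding (sym)
open import Data.Nat using (ℕ; suc; _≤_)
open import Data.Nat.Properties using (<⇒≤; ≤-trans; ≤-<-trans; <⇒≱)
open import Data.Fin using (Fin; _≟_; _<_) renaming (_≤_ to _≤ᶠ_)
open import Data.Fin.Properties using (<-cmp; <⇒≢; ≤-refl)
open import Data.List using (List; []; _∷_; filter; length)
open import Data.List.Properties using (filter-accept; filter-reject; filter-none)
open import Data.List.Relation.Unary.All as All using (All; []; _∷_)
open import Data.List.Relation.Unary.Any using (Any; here; there)
open import Data.List.Relation.Unary.AllPairs using ([]; _∷_)
open import Data.List.Membership.Propositional using (_∈_; find)
open import Data.List.Membership.Propositional.Properties using (∈-filter⁻)
open import Data.List.Relation.Binary.Subset.Propositional using (_⊆_)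
open import Data.List.Relation.Binary.Subset.Propositional.Properties
  using (Any-resp-⊆; ∷⁺ʳ)
open import Data.Product using (_×_; ∃; _,_)
open import Relation.Binary.PropositionalEquality using (_≡_; _≢_; refl; sym; cong; trans; subst)
open import Relation.Binary.Definitions using (tri<; tri≈; tri>)
open import Data.Empty using (⊥-elim)

module _ {A : Set} {k : ℕ} (f : A → Fin k) where

  count : Fin k → List A → ℕ
  count i xs = length (filter (λ w → f w ≟ i) xs)

  count-∷-≡ : ∀ {i x} xs → f x ≡ i → count i (x ∷ xs) ≡ suc (count i xs)
  count-∷-≡ xs fx≡i = cong length (filter-accept (λ w → f w ≟ _) {xs = xs} fx≡i)

  count-∷-≢ : ∀ {i x} xs → f x ≢ i → count i (x ∷ xs) ≡ count i xs
  count-∷-≢ xs fx≢i = cong length (filter-reject (λ w → f w ≟ _) {xs = xs} fx≢i)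

  count-below : ∀ {i xs} → All (λ w → f w < i) xs → count i xs ≡ 0
  count-below fxs<i = cong length (filter-none (λ w → f w ≟ _) (All.map <⇒≢ fxs<i))

  count≡1⇒∈ : ∀ {i} xs → count i xs ≡ 1 → ∃ λ y → y ∈ xs × f y ≡ i
  count≡1⇒∈ {i} xs c≡1 with filter (λ w → f w ≟ i) xs in accepted
  count≡1⇒∈ {i} xs refl | y ∷ [] =
    y , ∈-filter⁻ (λ w → f w ≟ i) {xs = xs} (subst (y ∈_) (sym accepted) (here refl))

  IsUniqueMax : List A → Fin k → Set
  IsUniqueMax xs i = count i xs ≡ 1 × All (λ w → f w ≤ᶠ i) xs

module _ {n : ℕ} (G : Graph n) where

  path-prefix : ∀ {u v y vs} → Path G u v vs → y ∈ vs → ∃ λ ps → Path G u y ps × ps ⊆ vs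
  path-prefix (here , _) (here refl) = _ , (here , [] ∷ []) , λ p → p
  path-prefix (step a W , _) (here refl) = _ , (here , [] ∷ []) , λ { (here refl) → here refl }
  path-prefix (step a W , u∉vs ∷ vs-unique) (there y∈vs)
    with path-prefix (W , vs-unique) y∈vs
  ... | ps , (W′ , ps-unique) , ps⊆vs =
    _ , (step a W′ , All.tabulate (λ w∈ps → All.lookup u∉vs (ps⊆vs w∈ps)) ∷ ps-unique)
      , ∷⁺ʳ _ ps⊆vs

  module _ {k : ℕ} {f : Fin n → Fin k} (ranking : IsRanking G k f) where

    ranking-along-path : ∀ {u v y vs} → Path G u v vs → y ∈ vs → u ≢ y → f u ≡ f y →
                         Any (λ w → f u < f w) vs
    ranking-along-path P y∈vs u≢y fu≡fy with path-prefix P y∈vs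
    ... | ps , Pps , ps⊆vs = Any-resp-⊆ ps⊆vs (ranking _ _ u≢y fu≡fy ps Pps)

    path-uniqueMax : ∀ {u v vs} → Path G u v vs → ∃ (IsUniqueMax f vs)
    path-uniqueMax {u} (here , _) = f u , count-∷-≡ f [] refl , ≤-refl ∷ []
    path-uniqueMax {u} {vs = u ∷ vs} P@(step a W , u∉vs ∷ vs-unique)
      with path-uniqueMax (W , vs-unique)
    ... | i , c≡1 , vs≤i with <-cmp (f u) i
    ... | tri< fu<i _ _ = i , trans (count-∷-≢ f vs (<⇒≢ fu<i)) c≡1 , <⇒≤ fu<i ∷ vs≤i
    ... | tri> _ _ i<fu =
      f u , trans (count-∷-≡ f vs refl) (cong suc (count-below f vs<fu))
          , ≤-refl ∷ All.map (λ w≤i → ≤-trans w≤i (<⇒≤ i<fu)) vs≤i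
      where
      vs<fu : All (λ w → f w < f u) vs
      vs<fu = All.map (λ w≤i → ≤-<-trans w≤i i<fu) vs≤i
    ... | tri≈ _ refl _ with count≡1⇒∈ f vs c≡1
    ... | y , y∈vs , fy≡fu
      with find (ranking-along-path P (there y∈vs) (All.lookup u∉vs y∈vs) (sym fy≡fu))
    ... | w , w∈ , fu<fw = ⊥-elim (<⇒≱ fu<fw (All.lookup (≤-refl ∷ vs≤i) w∈))

    ranking⇒cfConnecting : Connected G → IsCFConnecting G k f
    ranking⇒cfConnecting connected u v with connected u v
    ... | vs , P with path-uniqueMax P
    ... | i , c≡1 , _ = vs , P , i , c≡1

lemma4 : (n : ℕ) (G : Graph n) → Connected G →
    (r m : ℕ) → IsRankingNumber G r → IsVcfc G m → m ≤ r
lemma4 n G connected r m ((f , ranking) , _) (_ , vcfc-minimal) =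
  vcfc-minimal r (f , ranking⇒cfConnecting G ranking connected)
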